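{- If $m$ is an even positive integer, then $$\binom{2m-1}{m-1}\not\equiv 1 \pmod{m^2}.$$ -}

module Defs where

open import Data.Nat using (ℕ; _*_; _%_; NonZero)
open import Data.Nat.Properties using (m*n≢0)
open import Relation.Binary.PropositionalEquality using (_≡_)

_≡_[mod_²] : ℕ → ℕ → (m : ℕ) → .{{NonZero m}} → Set
a ≡ b [mod m ²] = (a % (m * m)) {{m*n≢0 m m}} ≡ (b % (m * m)) {{m*n≢0 m m}}

{-# OPTIONS --safe #-}
-- Write B n = C(2n−1, n−1) = C(2n, n)/2. Comparing coefficients in
-- (1 + x)⁴ᴺ ≡ (1 + x²)²ᴺ (mod 4) and propagating along Pascal's rule gives
--   B (2n)   = C(4n−1, 2n−1) ≡ C(2n−1, n−1) + 2·C(2n−2, n−1) ≡ B n   (mod 4, n ≥ 2),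
--   B (2n+1) = C(4n+1, 2n)   ≡ C(2n, n)                              (mod 4),
-- using that central binomial coefficients are even. So B of an odd number ≥ 3 is
-- even, B 2 = 3, and by strong induction B n ≢ 1 (mod 4) for n ≥ 2. For even m we
-- have 4 ∣ m², so B m ≢ 1 (mod m²) a fortiori.
module Submission where

open import Defs
open import Data.Nat
  using (ℕ; zero; suc; _+_; _*_; _∸_; _%_; _≤_; _<_; z≤n; s≤s; NonZero)
open import Data.Nat.Combinatorics using (_C_; nCk+nC[k+1]≡[n+1]C[k+1]; nC1≡n; nCk≡nC[n∸k])
open import Data.Nat.DivMod using (%-distribˡ-+; [m+kn]%n≡m%n; m∣n⇒o%n%m≡o%m)
open import Data.Nat.Divisibility using (_∣_; ∣⇒≤; *-pres-∣)
open import Data.Nat.Induction using (<-rec)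
open import Data.Nat.Properties using (+-suc; +-comm; +-identityʳ; m*n≢0; m≤n⇒m≤1+n; m+n∸n≡m)
open import Data.Nat.Solver using (module +-*-Solver)
open import Data.Product using (_×_; _,_; proj₁; proj₂)
open import Level using (0ℓ)
open import Relation.Binary.Bundles using (Setoid)
open import Relation.Binary.Structures using (IsEquivalence)
import Relation.Binary.Reasoning.Setoid as SetoidReasoning
open import Relation.Binary.PropositionalEquality
  using (_≡_; refl; sym; trans; cong; cong₂; subst; module ≡-Reasoning)
open import Relation.Nullary using (¬_)
open +-*-Solver

double : ℕ → ℕ
double zero    = zero
double (suc n) = suc (suc (double n))

double≡+ : ∀ n → double n ≡ n + n
double≡+ zero    = refl
double≡+ (suc n) = cong suc (trans (cong suc (double≡+ n)) (sym (+-suc n n)))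

n≤double : ∀ n → n ≤ double n
n≤double zero    = z≤n
n≤double (suc n) = s≤s (m≤n⇒m≤1+n (n≤double n))

2*n≡double : ∀ n → 2 * n ≡ double n
2*n≡double n = trans (cong (n +_) (+-comm n 0)) (sym (double≡+ n))

data EvenOrOdd : ℕ → Set where
  even : ∀ k → EvenOrOdd (double k)
  odd  : ∀ k → EvenOrOdd (suc (double k))

evenOrOdd : ∀ n → EvenOrOdd n
evenOrOdd zero = even zero
evenOrOdd (suc n) with evenOrOdd n
... | even k = odd k
... | odd k  = even (suc k)

-- A record rather than a synonym for a % 4 ≡ b % 4, so that a and b can be
-- recovered by unification.
infix 4 _≡₄_
record _≡₄_ (a b : ℕ) : Set where
  constructor mod4
  field %4≡ : a % 4 ≡ b % 4
open _≡₄_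

≡⇒≡₄ : ∀ {a b} → a ≡ b → a ≡₄ b
≡⇒≡₄ refl = mod4 refl

≡₄-isEquivalence : IsEquivalence _≡₄_
≡₄-isEquivalence = record
  { refl  = mod4 refl
  ; sym   = λ (mod4 p) → mod4 (sym p)
  ; trans = λ (mod4 p) (mod4 q) → mod4 (trans p q)
  }

≡₄-setoid : Setoid 0ℓ 0ℓ
≡₄-setoid = record { isEquivalence = ≡₄-isEquivalence }

open Setoid ≡₄-setoid using () renaming (refl to ≡₄-refl; sym to ≡₄-sym; trans to ≡₄-trans)
module ≡₄-Reasoning = SetoidReasoning ≡₄-setoid

+-cong-≡₄ : ∀ {a a′ b b′} → a ≡₄ a′ → b ≡₄ b′ → a + b ≡₄ a′ + b′
+-cong-≡₄ {a} {a′} {b} {b′} (mod4 p) (mod4 q) = mod4 (begin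
  (a + b) % 4              ≡⟨ %-distribˡ-+ a b 4 ⟩
  (a % 4 + b % 4) % 4      ≡⟨ cong₂ (λ x y → (x + y) % 4) p q ⟩
  (a′ % 4 + b′ % 4) % 4    ≡⟨ %-distribˡ-+ a′ b′ 4 ⟨
  (a′ + b′) % 4            ∎)
  where open ≡-Reasoning

+-*4-≡₄ : ∀ x k → x + k * 4 ≡₄ x
+-*4-≡₄ x k = mod4 ([m+kn]%n≡m%n x k 4)

fourfold-≡₄0 : ∀ n → (n + n) + (n + n) ≡₄ 0
fourfold-≡₄0 n = ≡₄-trans
  (≡⇒≡₄ (solve 1 (λ n → (n :+ n) :+ (n :+ n) := con 0 :+ n :* con 4) refl n))
  (+-*4-≡₄ 0 n)

double²-≡₄0 : ∀ n → double (double n) ≡₄ 0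
double²-≡₄0 zero    = ≡₄-refl
double²-≡₄0 (suc n) = mod4 (%4≡ (double²-≡₄0 n))

double-≢₄1 : ∀ n → ¬ double n ≡₄ 1
double-≢₄1 zero          (mod4 ())
double-≢₄1 (suc zero)    (mod4 ())
double-≢₄1 (suc (suc n)) (mod4 p) = double-≢₄1 n (mod4 p)

≡[mod²]⇒≡₄ : ∀ {a b m} .{{_ : NonZero m}} → 2 ∣ m → a ≡ b [mod m ²] → a ≡₄ b
≡[mod²]⇒≡₄ {a} {b} {m} 2∣m a≡b = mod4 (begin
  a % 4              ≡⟨ m∣n⇒o%n%m≡o%m 4 (m * m) a 4∣m² ⟨
  a % (m * m) % 4    ≡⟨ cong (_% 4) a≡b ⟩
  b % (m * m) % 4    ≡⟨ m∣n⇒o%n%m≡o%m 4 (m * m) b 4∣m² ⟩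
  b % 4              ∎)
  where
  open ≡-Reasoning
  instance
    m²≢0 : NonZero (m * m)
    m²≢0 = m*n≢0 m m
  4∣m² : 4 ∣ m * m
  4∣m² = *-pres-∣ 2∣m 2∣m

pascal : ∀ n k → suc n C suc k ≡ n C k + n C suc k
pascal n k = sym (nCk+nC[k+1]≡[n+1]C[k+1] n k)

-- The coefficientwise form of (1 + x)⁴ᴺ ≡ (1 + x²)²ᴺ (mod 4), which holds because
-- (1 + x)² = (1 + x²) + 2x and (a + 2b)² ≡ a² (mod 4).
Lucas₄ : ℕ → Set
Lucas₄ N = ∀ k → (double (double N) C double k ≡₄ double N C k)
               × (double (double N) C suc (double k) ≡₄ 0)

module Lucas₄-step (N : ℕ) (row : Lucas₄ N) where
  open ≡₄-Reasoning

  X D : ℕ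
  X = double (double N)
  D = double N

  [X+1]C[2k]≡₄DCk : ∀ k → suc X C double k ≡₄ D C k
  [X+1]C[2k]≡₄DCk zero    = ≡₄-refl
  [X+1]C[2k]≡₄DCk (suc k) = begin
    suc X C double (suc k)                    ≡⟨ pascal X (suc (double k)) ⟩
    X C suc (double k) + X C double (suc k)   ≈⟨ +-cong-≡₄ (proj₂ (row k)) (proj₁ (row (suc k))) ⟩
    D C suc k                                 ∎

  [X+1]C[2k+1]≡₄DCk : ∀ k → suc X C suc (double k) ≡₄ D C k
  [X+1]C[2k+1]≡₄DCk k = begin
    suc X C suc (double k)                    ≡⟨ pascal X (double k) ⟩
    X C double k + X C suc (double k)         ≈⟨ +-cong-≡₄ (proj₁ (row k)) (proj₂ (row k)) ⟩
    D C k + 0                                 ≡⟨ +-identityʳ (D C k) ⟩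
    D C k                                     ∎

  [X+2]C[2k]≡₄[D+1]Ck : ∀ k → suc (suc X) C double k ≡₄ suc D C k
  [X+2]C[2k]≡₄[D+1]Ck zero    = ≡₄-refl
  [X+2]C[2k]≡₄[D+1]Ck (suc k) = begin
    suc (suc X) C double (suc k)                      ≡⟨ pascal (suc X) (suc (double k)) ⟩
    suc X C suc (double k) + suc X C double (suc k)   ≈⟨ +-cong-≡₄ ([X+1]C[2k+1]≡₄DCk k) ([X+1]C[2k]≡₄DCk (suc k)) ⟩
    D C k + D C suc k                                 ≡⟨ pascal D k ⟨
    suc D C suc k                                     ∎

  [X+2]C[2k+1]≡₄DCk+DCk : ∀ k → suc (suc X) C suc (double k) ≡₄ D C k + D C k
  [X+2]C[2k+1]≡₄DCk+DCk k = begin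
    suc (suc X) C suc (double k)              ≡⟨ pascal (suc X) (double k) ⟩
    suc X C double k + suc X C suc (double k) ≈⟨ +-cong-≡₄ ([X+1]C[2k]≡₄DCk k) ([X+1]C[2k+1]≡₄DCk k) ⟩
    D C k + D C k                             ∎

  [X+3]C[2k+1]≡₄[D+1]Ck+2DCk : ∀ k → suc (suc (suc X)) C suc (double k) ≡₄ suc D C k + (D C k + D C k)
  [X+3]C[2k+1]≡₄[D+1]Ck+2DCk k = ≡₄-trans (≡⇒≡₄ (pascal (suc (suc X)) (double k)))
    (+-cong-≡₄ ([X+2]C[2k]≡₄[D+1]Ck k) ([X+2]C[2k+1]≡₄DCk+DCk k))

  [X+3]C[2k+2]≡₄2DCk+[D+1]C[k+1] : ∀ k → suc (suc (suc X)) C double (suc k) ≡₄ (D C k + D C k) + suc D C suc k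
  [X+3]C[2k+2]≡₄2DCk+[D+1]C[k+1] k = ≡₄-trans (≡⇒≡₄ (pascal (suc (suc X)) (suc (double k))))
    (+-cong-≡₄ ([X+2]C[2k+1]≡₄DCk+DCk k) ([X+2]C[2k]≡₄[D+1]Ck (suc k)))

  [X+4]C[2k]≡₄[D+2]Ck : ∀ k → double (double (suc N)) C double k ≡₄ double (suc N) C k
  [X+4]C[2k]≡₄[D+2]Ck zero    = ≡₄-refl
  [X+4]C[2k]≡₄[D+2]Ck (suc k) = begin
    suc Y C double (suc k)                            ≡⟨ pascal Y (suc (double k)) ⟩
    Y C suc (double k) + Y C double (suc k)           ≈⟨ +-cong-≡₄ ([X+3]C[2k+1]≡₄[D+1]Ck+2DCk k) ([X+3]C[2k+2]≡₄2DCk+[D+1]C[k+1] k) ⟩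
    (b + (a + a)) + ((a + a) + c)                     ≡⟨ solve 3 (λ a b c → (b :+ (a :+ a)) :+ ((a :+ a) :+ c) := (b :+ c) :+ a :* con 4) refl a b c ⟩
    (b + c) + a * 4                                   ≈⟨ +-*4-≡₄ (b + c) a ⟩
    b + c                                             ≡⟨ pascal (suc D) k ⟨
    suc (suc D) C suc k                               ∎
    where
    Y a b c : ℕ
    Y = suc (suc (suc X))
    a = D C k
    b = suc D C k
    c = suc D C suc k

  [X+4]C[2k+1]≡₄0 : ∀ k → double (double (suc N)) C suc (double k) ≡₄ 0
  [X+4]C[2k+1]≡₄0 zero    = ≡₄-trans (≡⇒≡₄ (nC1≡n (double (double (suc N))))) (double²-≡₄0 (suc N))
  [X+4]C[2k+1]≡₄0 (suc k) = begin
    suc Y C suc (double (suc k))                      ≡⟨ pascal Y (double (suc k)) ⟩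
    Y C double (suc k) + Y C suc (double (suc k))     ≈⟨ +-cong-≡₄ ([X+3]C[2k+2]≡₄2DCk+[D+1]C[k+1] k) ([X+3]C[2k+1]≡₄[D+1]Ck+2DCk (suc k)) ⟩
    ((a + a) + c) + (c + (e + e))                     ≡⟨ solve 3 (λ a c e → ((a :+ a) :+ c) :+ (c :+ (e :+ e)) := (c :+ (a :+ e)) :+ (c :+ (a :+ e))) refl a c e ⟩
    (c + (a + e)) + (c + (a + e))                     ≡⟨ cong (λ z → (c + z) + (c + z)) (pascal D k) ⟨
    (c + c) + (c + c)                                 ≈⟨ fourfold-≡₄0 c ⟩
    0                                                 ∎
    where
    Y a c e : ℕ
    Y = suc (suc (suc X))
    a = D C k
    c = suc D C suc k
    e = D C suc k

  lucas₄-suc : Lucas₄ (suc N)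
  lucas₄-suc k = [X+4]C[2k]≡₄[D+2]Ck k , [X+4]C[2k+1]≡₄0 k

lucas₄ : ∀ N → Lucas₄ N
lucas₄ zero    zero    = ≡₄-refl , ≡₄-refl
lucas₄ zero    (suc k) = ≡₄-refl , ≡₄-refl
lucas₄ (suc N)         = Lucas₄-step.lucas₄-suc N (lucas₄ N)

centralBinomial≡double : ∀ n → double (suc n) C suc n ≡ double (suc (double n) C n)
centralBinomial≡double n = begin
  suc (suc (double n)) C suc n                    ≡⟨ pascal (suc (double n)) n ⟩
  suc (double n) C n + suc (double n) C suc n     ≡⟨ cong (suc (double n) C n +_) symmetry ⟩
  suc (double n) C n + suc (double n) C n         ≡⟨ double≡+ (suc (double n) C n) ⟨
  double (suc (double n) C n)                     ∎
  where
  open ≡-Reasoning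
  symmetry : suc (double n) C suc n ≡ suc (double n) C n
  symmetry = trans (nCk≡nC[n∸k] (s≤s (n≤double n)))
                   (cong (suc (double n) C_) (trans (cong (_∸ n) (double≡+ n)) (m+n∸n≡m n n)))

halfCentral : ℕ → ℕ
halfCentral n = (double n ∸ 1) C (n ∸ 1)

halfCentral-double-≡₄ : ∀ n → halfCentral (double (suc (suc n))) ≡₄ halfCentral (suc (suc n))
halfCentral-double-≡₄ n = begin
  halfCentral (double (suc (suc n)))    ≈⟨ [X+3]C[2k+1]≡₄[D+1]Ck+2DCk (suc n) ⟩
  h + (c + c)                           ≡⟨ cong (λ z → h + (z + z)) (centralBinomial≡double n) ⟩
  h + (double e + double e)             ≡⟨ cong (h +_) (double≡+ (double e)) ⟨
  h + double (double e)                 ≈⟨ +-cong-≡₄ (≡₄-refl {h}) (double²-≡₄0 e) ⟩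
  h + 0                                 ≡⟨ +-identityʳ h ⟩
  h                                     ∎
  where
  open ≡₄-Reasoning
  open Lucas₄-step (suc n) (lucas₄ (suc n))
  h c e : ℕ
  h = halfCentral (suc (suc n))
  c = double (suc n) C suc n
  e = suc (double n) C n

halfCentral-odd-≢₄1 : ∀ n → ¬ halfCentral (suc (double (suc n))) ≡₄ 1
halfCentral-odd-≢₄1 n h≡₄1 = double-≢₄1 (suc (double n) C n) (begin
  double (suc (double n) C n)              ≡⟨ centralBinomial≡double n ⟨
  double (suc n) C suc n                   ≈⟨ [X+1]C[2k]≡₄DCk (suc n) ⟨
  halfCentral (suc (double (suc n)))       ≈⟨ h≡₄1 ⟩
  1                                        ∎)
  where
  open ≡₄-Reasoning
  open Lucas₄-step (suc n) (lucas₄ (suc n))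

halfCentral-≢₄1 : ∀ n → 2 ≤ n → ¬ halfCentral n ≡₄ 1
halfCentral-≢₄1 = <-rec (λ n → 2 ≤ n → ¬ halfCentral n ≡₄ 1) step
  where
  step : ∀ n → (∀ {m} → m < n → 2 ≤ m → ¬ halfCentral m ≡₄ 1) → 2 ≤ n → ¬ halfCentral n ≡₄ 1
  step n ih 2≤n with evenOrOdd n
  step .0 _ ()       | even zero
  step .1 _ (s≤s ()) | odd zero
  ... | even (suc zero)    = λ ()
  ... | even (suc (suc k)) = λ h≡₄1 → ih (s≤s (s≤s (n≤double (suc k)))) (s≤s (s≤s z≤n))
                                        (≡₄-trans (≡₄-sym (halfCentral-double-≡₄ k)) h≡₄1)
  ... | odd (suc k)        = halfCentral-odd-≢₄1 k

theorem6 : (m : ℕ) → .{{_ : NonZero m}} → 2 ∣ m →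
           ¬ (((2 * m ∸ 1) C (m ∸ 1)) ≡ 1 [mod m ²])
theorem6 m 2∣m C≡1 = halfCentral-≢₄1 m (∣⇒≤ 2∣m)
  (subst (λ x → (x ∸ 1) C (m ∸ 1) ≡₄ 1) (2*n≡double m) (≡[mod²]⇒≡₄ 2∣m C≡1))
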